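{- Let $n \ge 1$ and $k \ge 1$. The number of pairs $(T,v)$ with $T \in \mathcal{T}_n$ and $v$ a vertex of $T$ of degree $k$ equals twice the number of pairs $(T,v)$ with $T \in \mathcal{T}_n$ and $v$ a vertex of $T$ of outdegree $k$.
   Context: $\mathcal{T}_n$ denotes the set of rooted ordered (plane) trees with $n$ edges. The degree of a vertex is the number of edges incident to it; the outdegree of a vertex is the number of its children (edges from it pointing away from the root). -}

module Defs where

open import Data.Nat using (ℕ; zero; suc; _+_)
open import Data.List using (List; []; _∷_; length; map; filter)
open import Data.Nat.ListAction using (sum)
open import Data.Bool using (Bool; true; false)
open import Data.Nat using (_≟_)
open import Relation.Nullary.Decidable using (⌊_⌋)

data Tree : Set where
  node : List Tree → Tree

mutual
  edges : Tree → ℕ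
  edges (node ts) = edgesF ts

  edgesF : List Tree → ℕ
  edgesF [] = 0
  edgesF (t ∷ ts) = suc (edges t + edgesF ts)

mutual
  outdegs : Tree → List ℕ
  outdegs (node ts) = length ts ∷ outdegsF ts

  outdegsF : List Tree → List ℕ
  outdegsF [] = []
  outdegsF (t ∷ ts) = outdegs t Data.List.++ outdegsF ts

-- degrees of all vertices of a tree, one entry per vertex (same order):
-- root has degree = outdegree; every non-root vertex has one extra edge (to its parent)
degs : Tree → List ℕ
degs (node ts) = length ts ∷ map suc (outdegsF ts)

count : ℕ → List ℕ → ℕ
count k xs = length (filter (λ x → x ≟ k) xs)

pairsDeg : ℕ → List Tree → ℕ
pairsDeg k Ts = sum (map (λ T → count k (degs T)) Ts)

pairsOutdeg : ℕ → List Tree → ℕ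
pairsOutdeg k Ts = sum (map (λ T → count k (outdegs T)) Ts)

-- A vertex of degree k + 1 is either the root with outdegree k + 1 or a non-root
-- vertex with outdegree k, so the claim says that over 𝒯ₙ the non-root vertices of
-- outdegree k are as many as the roots of outdegree k + 1 plus twice the non-root
-- vertices of outdegree k + 1. This balance holds over all plane forests with m edges
-- and l trees, by induction along the decomposition: such a forest either starts
-- with a leaf, or it is obtained from a forest with m - 1 edges and l + 1 trees by
-- grafting the first tree as the new leftmost subtree of the second root. Grafting
-- turns the first root into a non-root vertex and raises the outdegree of the second
-- root by one; the remaining asymmetry between the first two roots disappears after
-- summing, because exchanging them permutes the forests of a given size.
module Submission where

open import Defs
open import Data.Nat using (ℕ; zero; suc; _+_; _*_; _≥_; _≡ᵇ_; _≟_)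
open import Data.Bool using (true; false)
open import Data.Nat.Properties using (+-assoc; +-identityʳ; suc-injective)
open import Data.Nat.ListAction using (sum)
open import Data.Nat.ListAction.Properties using (sum-++; sum-↭)
open import Data.Nat.Tactic.RingSolver using (solve-∀)
open import Data.List using (List; []; _∷_; _++_; [_]; map; filter; length)
open import Data.List.Properties using (map-++; map-∘; map-cong; filter-++; length-++; ++-assoc; ++-identityʳ)
open import Data.List.Relation.Unary.Unique.Propositional using (Unique; []; _∷_)
import Data.List.Relation.Unary.Unique.Propositional.Properties as Unique
open import Data.List.Relation.Unary.All using ([])
open import Data.List.Relation.Unary.Any using (here)
open import Data.List.Membership.Propositional using (_∈_)
open import Data.List.Membership.Propositional.Properties using (∈-map⁺; ∈-map⁻; ∈-++⁺ˡ; ∈-++⁺ʳ; ∈-++⁻)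
open import Data.List.Membership.Propositional.Properties.WithK using (unique∧set⇒bag)
open import Data.List.Relation.Binary.BagAndSetEquality using (∼bag⇒↭)
import Data.List.Relation.Binary.Permutation.Propositional.Properties as Permutation
open import Data.Vec as Vec using (Vec; []; _∷_; head)
open import Data.Vec.Properties using (∷-injectiveʳ)
open import Data.Product using (_×_; _,_)
open import Data.Sum using (inj₁; inj₂)
open import Data.Empty using (⊥)
open import Function using (_∘_)
open import Function.Bundles using (_⇔_; mk⇔; Equivalence)
import Function.Properties.Equivalence as ⇔
open import Relation.Binary.PropositionalEquality
  using (_≡_; _≗_; refl; sym; trans; cong; cong₂; subst; module ≡-Reasoning)

private
  variable
    A B : Set
    l : ℕ

sumMap : (A → ℕ) → List A → ℕ
sumMap g xs = sum (map g xs)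

sumMap-++ : (g : A → ℕ) (xs ys : List A) → sumMap g (xs ++ ys) ≡ sumMap g xs + sumMap g ys
sumMap-++ g xs ys = trans (cong sum (map-++ g xs ys)) (sum-++ (map g xs) (map g ys))

sumMap-+ : (g h : A → ℕ) (xs : List A) →
           sumMap (λ x → g x + h x) xs ≡ sumMap g xs + sumMap h xs
sumMap-+ g h [] = refl
sumMap-+ g h (x ∷ xs) = trans (cong (g x + h x +_) (sumMap-+ g h xs)) (interchange (g x) (h x) _ _)
  where
  interchange : ∀ a b c d → a + b + (c + d) ≡ a + c + (b + d)
  interchange = solve-∀

sumMap-cong : {g h : A → ℕ} → g ≗ h → (xs : List A) → sumMap g xs ≡ sumMap h xs
sumMap-cong g≗h xs = cong sum (map-cong g≗h xs)

sumMap-map : (g : B → ℕ) (h : A → B) (xs : List A) → sumMap g (map h xs) ≡ sumMap (g ∘ h) xs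
sumMap-map g h xs = cong sum (sym (map-∘ xs))

Enumerates : (A → Set) → List A → Set
Enumerates P xs = Unique xs × (∀ x → x ∈ xs ⇔ P x)

sumMap-enumerations : {P : A → Set} {xs ys : List A} (g : A → ℕ) →
                      Enumerates P xs → Enumerates P ys → sumMap g xs ≡ sumMap g ys
sumMap-enumerations g (xs! , ∈xs⇔P) (ys! , ∈ys⇔P) =
  sum-↭ (Permutation.map⁺ g (∼bag⇒↭ (unique∧set⇒bag xs! ys!
    λ {x} → ⇔.trans (∈xs⇔P x) (⇔.sym (∈ys⇔P x)))))

enumerates-⇔ : {P Q : A → Set} {xs : List A} →
               (∀ x → P x ⇔ Q x) → Enumerates P xs → Enumerates Q xs
enumerates-⇔ P⇔Q (xs! , ∈xs⇔P) = xs! , λ x → ⇔.trans (∈xs⇔P x) (P⇔Q x)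

map-enumerates : {P : A → Set} {xs : List A} (h : A → B) (h⁻¹ : B → A) →
                 (∀ x → h⁻¹ (h x) ≡ x) → (∀ y → h (h⁻¹ y) ≡ y) →
                 Enumerates P xs → Enumerates (P ∘ h⁻¹) (map h xs)
map-enumerates {P = P} {xs} h h⁻¹ left right (xs! , ∈xs⇔P) = Unique.map⁺ h-injective xs! , ∈-map⇔
  where
  h-injective : ∀ {x y} → h x ≡ h y → x ≡ y
  h-injective {x} {y} e = trans (sym (left x)) (trans (cong h⁻¹ e) (left y))
  ∈-map⇔ : ∀ y → y ∈ map h xs ⇔ P (h⁻¹ y)
  ∈-map⇔ y = mk⇔ to from
    where
    to : y ∈ map h xs → P (h⁻¹ y)
    to y∈ with ∈-map⁻ h y∈
    ... | x , x∈xs , refl = subst P (sym (left x)) (Equivalence.to (∈xs⇔P x) x∈xs)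
    from : P (h⁻¹ y) → y ∈ map h xs
    from p = subst (_∈ map h xs) (right y) (∈-map⁺ h (Equivalence.from (∈xs⇔P (h⁻¹ y)) p))

count-∷ : ∀ j x xs → count j (x ∷ xs) ≡ count j [ x ] + count j xs
count-∷ j x xs = trans (cong length (filter-++ (_≟ j) [ x ] xs)) (length-++ (filter (_≟ j) [ x ]))

count-[suc] : ∀ k x → count (suc k) [ suc x ] ≡ count k [ x ]
count-[suc] k x with x ≡ᵇ k
... | true  = refl
... | false = refl

count-map-suc : ∀ k xs → count (suc k) (map suc xs) ≡ count k xs
count-map-suc k [] = refl
count-map-suc k (x ∷ xs) = begin
  count (suc k) (suc x ∷ map suc xs)
    ≡⟨ count-∷ (suc k) (suc x) (map suc xs) ⟩
  count (suc k) [ suc x ] + count (suc k) (map suc xs)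
    ≡⟨ cong₂ _+_ (count-[suc] k x) (count-map-suc k xs) ⟩
  count k [ x ] + count k xs
    ≡⟨ sym (count-∷ k x xs) ⟩
  count k (x ∷ xs) ∎
  where open ≡-Reasoning

leaf : Tree
leaf = node []

size : Vec Tree l → ℕ
size []      = 0
size (t ∷ f) = edges t + size f

graft : Vec Tree (2 + l) → Vec Tree (1 + l)
graft (t ∷ node ts ∷ f) = node (t ∷ ts) ∷ f

graft-injective : {f g : Vec Tree (2 + l)} → graft f ≡ graft g → f ≡ g
graft-injective {f = _ ∷ node _ ∷ _} {_ ∷ node _ ∷ _} refl = refl

size-graft : (f : Vec Tree (2 + l)) → size (graft f) ≡ suc (size f)
size-graft (t ∷ node ts ∷ f) = cong suc (+-assoc (edges t) (edgesF ts) (size f))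

swap : Vec Tree (2 + l) → Vec Tree (2 + l)
swap (s ∷ t ∷ f) = t ∷ s ∷ f

swap-involutive : (f : Vec Tree (2 + l)) → swap (swap f) ≡ f
swap-involutive (s ∷ t ∷ f) = refl

size-swap : (f : Vec Tree (2 + l)) → size (swap f) ≡ size f
size-swap (s ∷ t ∷ f) = exchange (edges t) (edges s) (size f)
  where
  exchange : ∀ a b c → a + (b + c) ≡ b + (a + c)
  exchange = solve-∀

-- grafts m l lists the forests with m edges and l + 1 trees whose first tree is not a leaf.
-- The suc l clause comes first, so that forests m (suc l) unfolds for a variable m.
mutual
  forests : ℕ → (l : ℕ) → List (Vec Tree l)
  forests m (suc l)    = map (leaf ∷_) (forests m l) ++ grafts m l
  forests zero zero    = [ [] ]
  forests (suc m) zero = []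

  grafts : ℕ → (l : ℕ) → List (Vec Tree (suc l))
  grafts zero l    = []
  grafts (suc m) l = map graft (forests m (2 + l))

mutual
  ∈-forests⁻ : ∀ m {l} {f : Vec Tree l} → f ∈ forests m l → size f ≡ m
  ∈-forests⁻ m {suc l} f∈ with ∈-++⁻ (map (leaf ∷_) (forests m l)) f∈
  ... | inj₂ f∈grafts = ∈-grafts⁻ m f∈grafts
  ... | inj₁ f∈leaf∷ with ∈-map⁻ (leaf ∷_) f∈leaf∷
  ...   | g , g∈ , refl = ∈-forests⁻ m g∈
  ∈-forests⁻ zero {zero} (here refl) = refl

  ∈-grafts⁻ : ∀ m {l} {f : Vec Tree (suc l)} → f ∈ grafts m l → size f ≡ m
  ∈-grafts⁻ (suc m) f∈ with ∈-map⁻ graft f∈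
  ... | g , g∈ , refl = trans (size-graft g) (cong suc (∈-forests⁻ m g∈))

∈-forests⁺ : ∀ m {l} (f : Vec Tree l) → size f ≡ m → f ∈ forests m l
∈-forests⁺ zero    []                    refl = here refl
∈-forests⁺ m       (node [] ∷ f)         e    = ∈-++⁺ˡ (∈-map⁺ (leaf ∷_) (∈-forests⁺ m f e))
∈-forests⁺ (suc m) {suc l} (node (t ∷ ts) ∷ f) e =
  ∈-++⁺ʳ (map (leaf ∷_) (forests (suc m) l))
    (∈-map⁺ graft (∈-forests⁺ m g (suc-injective (trans (sym (size-graft g)) e))))
  where g = t ∷ node ts ∷ f

leaf∷≢graft : (f : Vec Tree l) (g : Vec Tree (2 + l)) → leaf ∷ f ≡ graft g → ⊥
leaf∷≢graft f (_ ∷ node _ ∷ _) ()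

mutual
  forests-unique : ∀ m l → Unique (forests m l)
  forests-unique m (suc l)    =
    Unique.++⁺ (Unique.map⁺ ∷-injectiveʳ (forests-unique m l)) (grafts-unique m l) (disjoint m)
    where
    disjoint : ∀ m {f} → f ∈ map (leaf ∷_) (forests m l) × f ∈ grafts m l → ⊥
    disjoint (suc m) (f∈leaf∷ , f∈grafts) with ∈-map⁻ (leaf ∷_) f∈leaf∷ | ∈-map⁻ graft f∈grafts
    ... | g , _ , refl | h , _ , e = leaf∷≢graft g h e
  forests-unique zero zero    = [] ∷ []
  forests-unique (suc m) zero = []

  grafts-unique : ∀ m l → Unique (grafts m l)
  grafts-unique zero l    = []
  grafts-unique (suc m) l = Unique.map⁺ graft-injective (forests-unique m (2 + l))

forests-enumerate : ∀ m l → Enumerates (λ f → size f ≡ m) (forests m l)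
forests-enumerate m l = forests-unique m l , λ f → mk⇔ (∈-forests⁻ m) (∈-forests⁺ m f)

rootOutdeg : Tree → ℕ
rootOutdeg (node ts) = length ts

rootOutdegs : Vec Tree l → List ℕ
rootOutdegs []      = []
rootOutdegs (t ∷ f) = rootOutdeg t ∷ rootOutdegs f

nonrootOutdegs : Vec Tree l → List ℕ
nonrootOutdegs []             = []
nonrootOutdegs (node ts ∷ f) = outdegsF ts ++ nonrootOutdegs f

#roots #nonroots : ℕ → Vec Tree l → ℕ
#roots    j f = count j (rootOutdegs f)
#nonroots j f = count j (nonrootOutdegs f)

rootIs : ℕ → Tree → ℕ
rootIs j t = count j [ rootOutdeg t ]

#nonroots-graft : ∀ j (f : Vec Tree (2 + l)) → #nonroots j (graft f) ≡ rootIs j (head f) + #nonroots j f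
#nonroots-graft j (node us ∷ node ts ∷ f) = begin
  count j ((length us ∷ outdegsF us ++ outdegsF ts) ++ nonrootOutdegs f)
    ≡⟨ cong (count j ∘ (length us ∷_)) (++-assoc (outdegsF us) (outdegsF ts) (nonrootOutdegs f)) ⟩
  count j (length us ∷ nonrootOutdegs (node us ∷ node ts ∷ f))
    ≡⟨ count-∷ j (length us) _ ⟩
  rootIs j (node us) + #nonroots j (node us ∷ node ts ∷ f) ∎
  where open ≡-Reasoning

#roots-graft : ∀ k (f : Vec Tree (2 + l)) →
               #roots (suc k) (graft f) + rootIs (suc k) (head f) + rootIs (suc k) (head (swap f))
               ≡ #roots (suc k) f + rootIs k (head (swap f))
#roots-graft k (s ∷ t@(node _) ∷ f) = begin
  count (suc k) (suc β ∷ rootOutdegs f) + rootIs (suc k) s + rootIs (suc k) t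
    ≡⟨ cong (λ z → z + rootIs (suc k) s + rootIs (suc k) t) (count-∷ (suc k) (suc β) (rootOutdegs f)) ⟩
  count (suc k) [ suc β ] + count (suc k) (rootOutdegs f) + rootIs (suc k) s + rootIs (suc k) t
    ≡⟨ cong (λ z → z + count (suc k) (rootOutdegs f) + rootIs (suc k) s + rootIs (suc k) t) (count-[suc] k β) ⟩
  rootIs k t + count (suc k) (rootOutdegs f) + rootIs (suc k) s + rootIs (suc k) t
    ≡⟨ rearrange (rootIs k t) (count (suc k) (rootOutdegs f)) (rootIs (suc k) s) (rootIs (suc k) t) ⟩
  rootIs (suc k) s + (rootIs (suc k) t + count (suc k) (rootOutdegs f)) + rootIs k t
    ≡⟨ cong (λ z → rootIs (suc k) s + z + rootIs k t) (sym (count-∷ (suc k) β (rootOutdegs f))) ⟩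
  rootIs (suc k) s + count (suc k) (β ∷ rootOutdegs f) + rootIs k t
    ≡⟨ cong (_+ rootIs k t) (sym (count-∷ (suc k) (rootOutdeg s) (β ∷ rootOutdegs f))) ⟩
  #roots (suc k) (s ∷ t ∷ f) + rootIs k t ∎
  where
  open ≡-Reasoning
  β = rootOutdeg t
  rearrange : ∀ a r b c → a + r + b + c ≡ b + (c + r) + a
  rearrange = solve-∀

sumMap-swap : ∀ m l (g : Vec Tree (2 + l) → ℕ) →
              sumMap (g ∘ swap) (forests m (2 + l)) ≡ sumMap g (forests m (2 + l))
sumMap-swap m l g = trans (sym (sumMap-map g swap (forests m (2 + l))))
  (sumMap-enumerations g swapped (forests-enumerate m (2 + l)))
  where
  swapped : Enumerates (λ f → size f ≡ m) (map swap (forests m (2 + l)))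
  swapped = enumerates-⇔ (λ f → mk⇔ (trans (sym (size-swap f))) (trans (size-swap f)))
    (map-enumerates swap swap swap-involutive swap-involutive (forests-enumerate m (2 + l)))

Balanced : ℕ → List (Vec Tree l) → Set
Balanced k fs = sumMap (#nonroots k) fs ≡ sumMap (#roots (suc k)) fs + 2 * sumMap (#nonroots (suc k)) fs

balanced-++ : ∀ k (xs ys : List (Vec Tree l)) → Balanced k xs → Balanced k ys → Balanced k (xs ++ ys)
balanced-++ k xs ys xs-balanced ys-balanced = begin
  sumMap (#nonroots k) (xs ++ ys)
    ≡⟨ sumMap-++ (#nonroots k) xs ys ⟩
  sumMap (#nonroots k) xs + sumMap (#nonroots k) ys
    ≡⟨ cong₂ _+_ xs-balanced ys-balanced ⟩
  (R xs + 2 * N xs) + (R ys + 2 * N ys)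
    ≡⟨ interchange (R xs) (N xs) (R ys) (N ys) ⟩
  (R xs + R ys) + 2 * (N xs + N ys)
    ≡⟨ sym (cong₂ (λ r n → r + 2 * n) (sumMap-++ (#roots (suc k)) xs ys) (sumMap-++ (#nonroots (suc k)) xs ys)) ⟩
  R (xs ++ ys) + 2 * N (xs ++ ys) ∎
  where
  open ≡-Reasoning
  R N : List (Vec Tree l) → ℕ
  R = sumMap (#roots (suc k))
  N = sumMap (#nonroots (suc k))
  interchange : ∀ a b c d → (a + 2 * b) + (c + 2 * d) ≡ (a + c) + 2 * (b + d)
  interchange = solve-∀

-- Prepending a leaf adds a root of outdegree 0 ≠ suc k and no non-root vertex.
balanced-leaf∷ : ∀ k (xs : List (Vec Tree l)) → Balanced k xs → Balanced k (map (leaf ∷_) xs)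
balanced-leaf∷ k xs xs-balanced = begin
  sumMap (#nonroots k) (map (leaf ∷_) xs)
    ≡⟨ sumMap-map (#nonroots k) (leaf ∷_) xs ⟩
  sumMap (#nonroots k) xs
    ≡⟨ xs-balanced ⟩
  sumMap (#roots (suc k)) xs + 2 * sumMap (#nonroots (suc k)) xs
    ≡⟨ sym (cong₂ (λ r n → r + 2 * n) (sumMap-map (#roots (suc k)) (leaf ∷_) xs)
                                     (sumMap-map (#nonroots (suc k)) (leaf ∷_) xs)) ⟩
  sumMap (#roots (suc k)) (map (leaf ∷_) xs) + 2 * sumMap (#nonroots (suc k)) (map (leaf ∷_) xs) ∎
  where open ≡-Reasoning

sumMap-graft-nonroots : ∀ j (xs : List (Vec Tree (2 + l))) →
  sumMap (#nonroots j) (map graft xs) ≡ sumMap (rootIs j ∘ head) xs + sumMap (#nonroots j) xs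
sumMap-graft-nonroots j xs = begin
  sumMap (#nonroots j) (map graft xs)                 ≡⟨ sumMap-map (#nonroots j) graft xs ⟩
  sumMap (#nonroots j ∘ graft) xs                     ≡⟨ sumMap-cong (#nonroots-graft j) xs ⟩
  sumMap (λ f → rootIs j (head f) + #nonroots j f) xs ≡⟨ sumMap-+ (rootIs j ∘ head) (#nonroots j) xs ⟩
  sumMap (rootIs j ∘ head) xs + sumMap (#nonroots j) xs ∎
  where open ≡-Reasoning

sumMap-graft-roots : ∀ k (xs : List (Vec Tree (2 + l))) →
  sumMap (#roots (suc k)) (map graft xs) + sumMap (rootIs (suc k) ∘ head) xs
    + sumMap (rootIs (suc k) ∘ head ∘ swap) xs
  ≡ sumMap (#roots (suc k)) xs + sumMap (rootIs k ∘ head ∘ swap) xs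
sumMap-graft-roots k xs = begin
  sumMap (#roots (suc k)) (map graft xs) + sumMap first xs + sumMap second xs
    ≡⟨ cong (λ z → z + sumMap first xs + sumMap second xs) (sumMap-map (#roots (suc k)) graft xs) ⟩
  sumMap (#roots (suc k) ∘ graft) xs + sumMap first xs + sumMap second xs
    ≡⟨ cong (_+ sumMap second xs) (sym (sumMap-+ (#roots (suc k) ∘ graft) first xs)) ⟩
  sumMap (λ f → #roots (suc k) (graft f) + first f) xs + sumMap second xs
    ≡⟨ sym (sumMap-+ (λ f → #roots (suc k) (graft f) + first f) second xs) ⟩
  sumMap (λ f → #roots (suc k) (graft f) + first f + second f) xs
    ≡⟨ sumMap-cong (#roots-graft k) xs ⟩
  sumMap (λ f → #roots (suc k) f + rootIs k (head (swap f))) xs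
    ≡⟨ sumMap-+ (#roots (suc k)) (rootIs k ∘ head ∘ swap) xs ⟩
  sumMap (#roots (suc k)) xs + sumMap (rootIs k ∘ head ∘ swap) xs ∎
  where
  open ≡-Reasoning
  first second : Vec Tree (2 + l) → ℕ
  first  = rootIs (suc k) ∘ head
  second = rootIs (suc k) ∘ head ∘ swap

balanced-graft : ∀ k m l → Balanced k (forests m (2 + l)) → Balanced k (map graft (forests m (2 + l)))
balanced-graft k m l xs-balanced = begin
  sumMap (#nonroots k) (map graft xs)
    ≡⟨ sumMap-graft-nonroots k xs ⟩
  first k + sumMap (#nonroots k) xs
    ≡⟨ cong (first k +_) xs-balanced ⟩
  first k + (R + 2 * N)
    ≡⟨ regroup (first k) R N ⟩
  (R + first k) + 2 * N
    ≡⟨ cong (_+ 2 * N) (sym grafted-roots) ⟩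
  (G + first (suc k) + first (suc k)) + 2 * N
    ≡⟨ double (first (suc k)) G N ⟩
  G + 2 * (first (suc k) + N)
    ≡⟨ cong (λ z → G + 2 * z) (sym (sumMap-graft-nonroots (suc k) xs)) ⟩
  G + 2 * sumMap (#nonroots (suc k)) (map graft xs) ∎
  where
  open ≡-Reasoning
  xs = forests m (2 + l)
  first : ℕ → ℕ
  first j = sumMap (rootIs j ∘ head) xs
  R = sumMap (#roots (suc k)) xs
  N = sumMap (#nonroots (suc k)) xs
  G = sumMap (#roots (suc k)) (map graft xs)
  grafted-roots : G + first (suc k) + first (suc k) ≡ R + first k
  grafted-roots = begin
    G + first (suc k) + first (suc k)
      ≡⟨ cong (G + first (suc k) +_) (sym (sumMap-swap m l (rootIs (suc k) ∘ head))) ⟩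
    G + first (suc k) + sumMap (rootIs (suc k) ∘ head ∘ swap) xs
      ≡⟨ sumMap-graft-roots k xs ⟩
    R + sumMap (rootIs k ∘ head ∘ swap) xs
      ≡⟨ cong (R +_) (sumMap-swap m l (rootIs k ∘ head)) ⟩
    R + first k ∎
  regroup : ∀ a r n → a + (r + 2 * n) ≡ (r + a) + 2 * n
  regroup = solve-∀
  double : ∀ a g n → (g + a + a) + 2 * n ≡ g + 2 * (a + n)
  double = solve-∀

mutual
  forests-balanced : ∀ k m l → Balanced k (forests m l)
  forests-balanced k m (suc l)    =
    balanced-++ k (map (leaf ∷_) (forests m l)) (grafts m l)
      (balanced-leaf∷ k (forests m l) (forests-balanced k m l)) (grafts-balanced k m l)
  forests-balanced k zero zero    = refl
  forests-balanced k (suc m) zero = refl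

  grafts-balanced : ∀ k m l → Balanced k (grafts m l)
  grafts-balanced k zero l    = refl
  grafts-balanced k (suc m) l = balanced-graft k m l (forests-balanced k m (2 + l))

count-outdegs : ∀ j (T : Tree) → count j (outdegs T) ≡ #roots j Vec.[ T ] + #nonroots j Vec.[ T ]
count-outdegs j (node ts) = trans (count-∷ j (length ts) (outdegsF ts))
  (cong (λ xs → count j [ length ts ] + count j xs) (sym (++-identityʳ (outdegsF ts))))

count-degs : ∀ k (T : Tree) → count (suc k) (degs T) ≡ #roots (suc k) Vec.[ T ] + #nonroots k Vec.[ T ]
count-degs k (node ts) = trans (count-∷ (suc k) (length ts) (map suc (outdegsF ts)))
  (cong (count (suc k) [ length ts ] +_)
    (trans (count-map-suc k (outdegsF ts)) (cong (count k) (sym (++-identityʳ (outdegsF ts))))))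

sumMap-trees : ∀ {n} {Ts : List Tree} → Enumerates (λ T → edges T ≡ n) Ts →
               (g : Vec Tree 1 → ℕ) → sumMap (g ∘ Vec.[_]) Ts ≡ sumMap g (forests n 1)
sumMap-trees {n} {Ts} Ts-enumerate g =
  trans (sym (sumMap-map g Vec.[_] Ts)) (sumMap-enumerations g singletons (forests-enumerate n 1))
  where
  head-[] : (f : Vec Tree 1) → Vec.[ head f ] ≡ f
  head-[] (T ∷ []) = refl
  size-[] : (f : Vec Tree 1) → edges (head f) ≡ n ⇔ size f ≡ n
  size-[] (T ∷ []) = mk⇔ (trans (+-identityʳ (edges T))) (trans (sym (+-identityʳ (edges T))))
  singletons : Enumerates (λ f → size f ≡ n) (map Vec.[_] Ts)
  singletons = enumerates-⇔ size-[] (map-enumerates Vec.[_] head (λ _ → refl) head-[] Ts-enumerate)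

corollary2p2 : (n k : ℕ) → n ≥ 1 → k ≥ 1 →
    (Ts : List Tree) → Unique Ts → (∀ T → (T ∈ Ts) ⇔ (edges T ≡ n)) →
    pairsDeg k Ts ≡ 2 * pairsOutdeg k Ts
corollary2p2 n (suc k) _ _ Ts Ts-unique Ts-complete = begin
  pairsDeg (suc k) Ts
    ≡⟨ sumMap-cong (count-degs k) Ts ⟩
  sumMap ((λ f → R f + #nonroots k f) ∘ Vec.[_]) Ts
    ≡⟨ sumMap-trees 𝒯ₙ (λ f → R f + #nonroots k f) ⟩
  sumMap (λ f → R f + #nonroots k f) ℱₙ
    ≡⟨ sumMap-+ R (#nonroots k) ℱₙ ⟩
  sumMap R ℱₙ + sumMap (#nonroots k) ℱₙ
    ≡⟨ cong (sumMap R ℱₙ +_) (forests-balanced k n 1) ⟩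
  sumMap R ℱₙ + (sumMap R ℱₙ + 2 * sumMap N ℱₙ)
    ≡⟨ twice (sumMap R ℱₙ) (sumMap N ℱₙ) ⟩
  2 * (sumMap R ℱₙ + sumMap N ℱₙ)
    ≡⟨ cong (2 *_) (sym (sumMap-+ R N ℱₙ)) ⟩
  2 * sumMap (λ f → R f + N f) ℱₙ
    ≡⟨ cong (2 *_) (sym (sumMap-trees 𝒯ₙ (λ f → R f + N f))) ⟩
  2 * sumMap ((λ f → R f + N f) ∘ Vec.[_]) Ts
    ≡⟨ cong (2 *_) (sym (sumMap-cong (count-outdegs (suc k)) Ts)) ⟩
  2 * pairsOutdeg (suc k) Ts ∎
  where
  open ≡-Reasoning
  𝒯ₙ = Ts-unique , Ts-complete
  ℱₙ = forests n 1
  R N : Vec Tree 1 → ℕ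
  R = #roots (suc k)
  N = #nonroots (suc k)
  twice : ∀ r n → r + (r + 2 * n) ≡ 2 * (r + n)
  twice = solve-∀
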